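{- If $q$ is a power of an odd prime, then the power graph $P(PSL(3,q))$ is not $\{P_{5}, \overline{P_{5}}\}$-free.
   Context: The power graph $P(G)$ of a group $G$ has vertex set $G$, with distinct $u,v$ adjacent if and only if $u=v^m$ or $v=u^n$ for some positive integers $m,n$. $P_5$ is the path on $5$ vertices and $\overline{P_5}$ its complement. A graph is $\{H_1,H_2\}$-free if it contains no induced subgraph isomorphic to $H_1$ and none isomorphic to $H_2$. -}

module Defs where

open import Level using (0ℓ)
open import Data.Nat using (ℕ; zero; suc; _≤_)
open import Data.Nat.Primality using (Prime)
open import Data.Fin using (Fin; toℕ)
open import Data.Fin.Patterns using (0F; 1F; 2F)
open import Data.Product using (Σ; ∃; _×_; _,_)
open import Data.Sum using (_⊎_)
open import Relation.Nullary using (¬_)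
open import Relation.Binary.PropositionalEquality as ≡ using (_≡_; _≢_)
open import Algebra.Bundles using (CommutativeRing)
open import Function.Bundles using (Inverse)

record FiniteField (q : ℕ) : Set₁ where
  field
    R        : CommutativeRing 0ℓ 0ℓ
  open CommutativeRing R public
  field
    1≉0      : ¬ (1# ≈ 0#)
    inverse  : ∀ x → ¬ (x ≈ 0#) → ∃ λ y → x * y ≈ 1#
    enum     : Inverse (≡.setoid (Fin q)) setoid

OddPrimePower : ℕ → Set
OddPrimePower q = Σ ℕ λ p → Σ ℕ λ k → Prime p × p ≢ 2 × 1 ≤ k × q ≡ p Data.Nat.^ k

module PSL3 {q : ℕ} (F : FiniteField q) where
  open FiniteField F

  Mat : Set
  Mat = Fin 3 → Fin 3 → Carrier

  _⊗_ : Mat → Mat → Mat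
  (A ⊗ B) i j = A i 0F * B 0F j + (A i 1F * B 1F j + A i 2F * B 2F j)

  I : Mat
  I 0F 0F = 1#
  I 1F 1F = 1#
  I 2F 2F = 1#
  I _  _  = 0#

  _^^_ : Mat → ℕ → Mat
  A ^^ zero  = I
  A ^^ suc m = A ⊗ (A ^^ m)

  det : Mat → Carrier
  det A = A 0F 0F * (A 1F 1F * A 2F 2F - A 1F 2F * A 2F 1F)
        - A 0F 1F * (A 1F 0F * A 2F 2F - A 1F 2F * A 2F 0F)
        + A 0F 2F * (A 1F 0F * A 2F 1F - A 1F 1F * A 2F 0F)

  SL3 : Set
  SL3 = Σ Mat λ A → det A ≈ 1#

  -- equality in PSL(3,q) = SL(3,q)/Z, Z = scalar matrices λI with λ³ = 1
  _∼_ : Mat → Mat → Set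
  A ∼ B = ∃ λ c → (c * (c * c) ≈ 1#) × (∀ i j → A i j ≈ c * B i j)

  -- adjacency in the power graph P(PSL(3,q)) on representatives
  PowAdj : SL3 → SL3 → Set
  PowAdj (A , _) (B , _) =
    ¬ (A ∼ B) ×
    ((∃ λ m → 1 ≤ m × A ∼ (B ^^ m)) ⊎ (∃ λ n → 1 ≤ n × B ∼ (A ^^ n)))

  HasInduced : (n : ℕ) → (Fin n → Fin n → Set) → Set
  HasInduced n H = Σ (Fin n → SL3) λ v →
    (∀ i j → i ≢ j → ¬ (Data.Product.proj₁ (v i) ∼ Data.Product.proj₁ (v j))) ×
    (∀ i j → i ≢ j → (H i j → PowAdj (v i) (v j)) × (PowAdj (v i) (v j) → H i j))

P5 : Fin 5 → Fin 5 → Set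
P5 i j = suc (toℕ i) ≡ toℕ j ⊎ suc (toℕ j) ≡ toℕ i

coP5 : Fin 5 → Fin 5 → Set
coP5 i j = ¬ P5 i j

NotP5coP5Free : {q : ℕ} → FiniteField q → Set
NotP5coP5Free F = HasInduced 5 P5 ⊎ HasInduced 5 coP5
  where open PSL3 F

-- The induced path g₁ — y₁ — u — y₂ — g₂ lives among the matrices
-- [[s,a,b],[0,1,0],[0,0,s]] with s = ±1.  Since q is odd, 2 ≠ 0 in the field and
-- some odd N has N·1 = 0.  For a ∈ {0,1} the matrix y = [[-1,a,1],[0,1,0],[0,0,-1]]
-- then has y^N = g = [[-1,a,0],[0,1,0],[0,0,-1]] and y^(N+1) = u = [[1,0,-1],[0,1,0],[0,0,1]].
-- Every power of y or g is again of the form [[1,0,*],…] or [[-1,a,*],…], and every power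
-- of u of the form [[1,0,*],…].  The middle entry 1 forces the scalar in PSL(3,q) to be 1,
-- so two such matrices are equal there only if they are equal entrywise; the sign s,
-- the entry a and, for u against powers of g, the entry b separate all non-edges.
module Submission where

open import Defs
open import Level using (0ℓ)
open import Data.Nat as ℕ using (ℕ; zero; suc)
open import Data.Fin using (Fin; toℕ)
open import Data.Fin.Patterns using (0F; 1F; 2F; 3F; 4F)
open import Data.Product using (∃; _×_; _,_; proj₁; proj₂)
open import Data.Sum using (_⊎_; inj₁; inj₂)
open import Function using (_∘′_; const)
open import Function.Bundles using (Inverse)
open import Relation.Binary.Bundles using (Setoid)
open import Relation.Nullary using (¬_; contradiction)
open import Relation.Nullary.Decidable using (Dec; True; False; toWitness; toWitnessFalse; _⊎-dec_)
import Relation.Binary.PropositionalEquality as ≡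
open ≡ using (_≡_; _≢_)
import Relation.Binary.Reasoning.Setoid as SetoidReasoning

module _ where
  open import Data.Nat using (_+_; _*_; _^_)
  open import Data.Nat.Properties using (+-suc; +-identityʳ; *-comm; +-0-commutativeMonoid)
  open import Data.Nat.Divisibility using (_∣_; divides; ∣1⇒≡1)
  open import Data.Nat.Primality using (Prime; ¬prime[1]; prime[2]; euclidsLemma; prime⇒irreducible)
  open import Data.Fin.Properties using (<-cmp; <-asym)
  open import Data.Fin.Permutation using (permutation)
  open import Relation.Binary.Definitions using (tri<; tri≈; tri>)
  open import Algebra.Properties.CommutativeMonoid.Sum +-0-commutativeMonoid
    using (sum-syntax; ∑-distrib-+; sum-permute; sum-cong-≗)
  open ≡ using (refl; sym; cong; subst)

  data Parity : ℕ → Set where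
    even : ∀ k → Parity (k + k)
    odd  : ∀ k → Parity (suc (k + k))

  parity : ∀ n → Parity n
  parity zero = even 0
  parity (suc n) with parity n
  ... | even k = odd k
  ... | odd k  = subst Parity (cong suc (+-suc k k)) (even (suc k))

  prime∣^⇒prime∣ : ∀ {p m} k → Prime p → p ∣ m ^ k → p ∣ m
  prime∣^⇒prime∣ zero pr p∣1 = contradiction (subst Prime (∣1⇒≡1 p∣1) pr) ¬prime[1]
  prime∣^⇒prime∣ {m = m} (suc k) pr p∣m^[1+k] with euclidsLemma m (m ^ k) pr p∣m^[1+k]
  ... | inj₁ p∣m   = p∣m
  ... | inj₂ p∣m^k = prime∣^⇒prime∣ k pr p∣m^k

  oddPrimePower⇒odd : ∀ {q} → OddPrimePower q → ¬ 2 ∣ q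
  oddPrimePower⇒odd (p , k , pr , p≢2 , _ , refl) 2∣p^k
    with prime⇒irreducible pr (prime∣^⇒prime∣ k prime[2] 2∣p^k)
  ... | inj₁ ()
  ... | inj₂ 2≡p = p≢2 (sym 2≡p)

  [_<_] : ∀ {n} → Fin n → Fin n → ℕ
  [ i < j ] with <-cmp i j
  ... | tri< _ _ _ = 1
  ... | _          = 0

  [<]+[>]≡1 : ∀ {n} {i j : Fin n} → i ≢ j → [ i < j ] + [ j < i ] ≡ 1
  [<]+[>]≡1 {i = i} {j} i≢j with <-cmp i j | <-cmp j i
  ... | tri< _ _ _   | tri> _ _ _   = refl
  ... | tri> _ _ _   | tri< _ _ _   = refl
  ... | tri≈ _ i≡j _ | _            = contradiction i≡j i≢j
  ... | _            | tri≈ _ j≡i _ = contradiction (sym j≡i) i≢j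
  ... | tri< i<j _ _ | tri< j<i _ _ = contradiction j<i (<-asym i<j)
  ... | tri> _ _ j<i | tri> _ _ i<j = contradiction j<i (<-asym i<j)

  P5? : ∀ i j → Dec (P5 i j)
  P5? i j = (suc (toℕ i) ℕ.≟ toℕ j) ⊎-dec (suc (toℕ j) ℕ.≟ toℕ i)

  ∑1≡n : ∀ n → ∑[ i < n ] 1 ≡ n
  ∑1≡n zero    = refl
  ∑1≡n (suc n) = cong suc (∑1≡n n)

  -- The points i with i < f i pick one point from each 2-cycle of f.
  fixedPointFree-involution⇒even : ∀ {n} (f : Fin n → Fin n) →
    (∀ i → f (f i) ≡ i) → (∀ i → f i ≢ i) → 2 ∣ n
  fixedPointFree-involution⇒even {n} f invol fpf = divides s (begin
    n                                        ≡⟨ sym (∑1≡n n) ⟩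
    ∑[ i < n ] 1                             ≡⟨ sum-cong-≗ (λ i → sym ([<]+[>]≡1 (fpf i ∘′ sym))) ⟩
    ∑[ i < n ] ([ i < f i ] + [ f i < i ])   ≡⟨ ∑-distrib-+ {n} (λ i → [ i < f i ]) (λ i → [ f i < i ]) ⟩
    s + ∑[ i < n ] [ f i < i ]               ≡⟨ cong (s +_) (sum-cong-≗ λ i → cong [ f i <_] (sym (invol i))) ⟩
    s + ∑[ i < n ] [ f i < f (f i) ]         ≡⟨ cong (s +_) (sym (sum-permute _ (permutation f f invol invol))) ⟩
    s + s                                    ≡⟨ cong (s +_) (sym (+-identityʳ s)) ⟩
    2 * s                                    ≡⟨ *-comm 2 s ⟩
    s * 2                                    ∎)
    where
    open ≡.≡-Reasoning
    s = ∑[ i < n ] [ i < f i ]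

module _ {q : ℕ} (F : FiniteField q) where
  open FiniteField F
  open PSL3 F
  open import Data.Nat.Properties using (n<1+n; <⇒≤; m<n⇒0<n∸m; m+[n∸m]≡n; m<m+n; +-suc)
  open import Data.Nat.Induction using (<-rec)
  open import Data.Nat.Divisibility using (_∣_)
  open import Data.Fin.Properties using (pigeonhole)
  open import Algebra.Properties.Ring ring
    using (-‿involutive; -1*x≈-x; -0#≈0#; -‿distribˡ-*; -‿+-comm; +-identityʳ-unique)
  open import Algebra.Properties.Semiring.Mult semiring using (×-homo-+) renaming (_×_ to _·_)
  open import Algebra.Solver.Ring.NaturalCoefficients.Default commutativeSemiring
    using (solve; _:=_; _:+_; _:*_; con)
  open Inverse enum using (to; from; from-cong; strictlyInverseˡ; strictlyInverseʳ)
  module ≈-Reasoning = SetoidReasoning setoid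

  from-injective : ∀ {x y} → from x ≡ from y → x ≈ y
  from-injective {x} {y} eq = begin
    x             ≈⟨ strictlyInverseˡ x ⟨
    to (from x)   ≡⟨ ≡.cong to eq ⟩
    to (from y)   ≈⟨ strictlyInverseˡ y ⟩
    y             ∎
    where open ≈-Reasoning

  positiveCharacteristic : ∃ λ d → 0 ℕ.< d × d · 1# ≈ 0#
  positiveCharacteristic with i , j , i<j , eq ← pigeonhole (n<1+n q) (λ i → from (toℕ i · 1#)) =
    toℕ j ℕ.∸ toℕ i , m<n⇒0<n∸m i<j , +-identityʳ-unique _ _ (begin
      toℕ i · 1# + (toℕ j ℕ.∸ toℕ i) · 1#   ≈⟨ ×-homo-+ 1# (toℕ i) _ ⟨
      (toℕ i ℕ.+ (toℕ j ℕ.∸ toℕ i)) · 1#    ≡⟨ ≡.cong (_· 1#) (m+[n∸m]≡n (<⇒≤ i<j)) ⟩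
      toℕ j · 1#                            ≈⟨ from-injective eq ⟨
      toℕ i · 1#                            ∎)
    where open ≈-Reasoning

  -- When 1 + 1 ≈ 0, translation by 1 is a fixed-point-free involution of the q elements.
  odd⇒1+1≉0 : ¬ 2 ∣ q → ¬ (1# + 1# ≈ 0#)
  odd⇒1+1≉0 q-odd 1+1≈0 = q-odd (fixedPointFree-involution⇒even shift shift-involutive shift-fixedPointFree)
    where
    open ≈-Reasoning

    shift : Fin q → Fin q
    shift i = from (to i + 1#)

    to-shift : ∀ i → to (shift i) ≈ to i + 1#
    to-shift i = strictlyInverseˡ _

    shift-involutive : ∀ i → shift (shift i) ≡ i
    shift-involutive i = ≡.trans (from-cong (begin
      to (shift i) + 1#   ≈⟨ +-congʳ (to-shift i) ⟩
      to i + 1# + 1#      ≈⟨ +-assoc _ _ _ ⟩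
      to i + (1# + 1#)    ≈⟨ +-congˡ 1+1≈0 ⟩
      to i + 0#           ≈⟨ +-identityʳ _ ⟩
      to i                ∎)) (strictlyInverseʳ i)

    shift-fixedPointFree : ∀ i → shift i ≢ i
    shift-fixedPointFree i eq = 1≉0 (+-identityʳ-unique (to i) 1# (begin
      to i + 1#      ≈⟨ to-shift i ⟨
      to (shift i)   ≡⟨ ≡.cong to eq ⟩
      to i           ∎))

  x≉0∧x*y≈0⇒y≈0 : ∀ {x y} → ¬ (x ≈ 0#) → x * y ≈ 0# → y ≈ 0#
  x≉0∧x*y≈0⇒y≈0 {x} {y} x≉0 xy≈0 with x⁻¹ , xx⁻¹≈1 ← inverse x x≉0 = begin
    y               ≈⟨ *-identityˡ y ⟨
    1# * y          ≈⟨ *-congʳ (trans (*-comm x⁻¹ x) xx⁻¹≈1) ⟨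
    x⁻¹ * x * y     ≈⟨ *-assoc x⁻¹ x y ⟩
    x⁻¹ * (x * y)   ≈⟨ *-congˡ xy≈0 ⟩
    x⁻¹ * 0#        ≈⟨ zeroʳ x⁻¹ ⟩
    0#              ∎
    where open ≈-Reasoning

  oddCharacteristic : ¬ (1# + 1# ≈ 0#) → ∃ λ k → suc (k ℕ.+ k) · 1# ≈ 0#
  oddCharacteristic 1+1≉0 with d , 0<d , d·1≈0 ← positiveCharacteristic = <-rec P halve d 0<d d·1≈0
    where
    open ≈-Reasoning

    P : ℕ → Set
    P d = 0 ℕ.< d → d · 1# ≈ 0# → ∃ λ k → suc (k ℕ.+ k) · 1# ≈ 0#

    halve : ∀ d → (∀ {e} → e ℕ.< d → P e) → P d
    halve d rec 0<d d·1≈0 with parity d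
    ... | odd k          = k , d·1≈0
    ... | even zero      = contradiction 0<d λ ()
    ... | even k@(suc _) = rec (m<m+n k ℕ.z<s) ℕ.z<s (x≉0∧x*y≈0⇒y≈0 1+1≉0 (begin
      (1# + 1#) * (k · 1#)             ≈⟨ distribʳ _ _ _ ⟩
      1# * (k · 1#) + 1# * (k · 1#)    ≈⟨ +-cong (*-identityˡ _) (*-identityˡ _) ⟩
      k · 1# + k · 1#                  ≈⟨ ×-homo-+ 1# k k ⟨
      (k ℕ.+ k) · 1#                   ≈⟨ d·1≈0 ⟩
      0#                               ∎))

  tri : Carrier → Carrier → Carrier → Mat
  tri s a b 0F 0F = s
  tri s a b 0F 1F = a
  tri s a b 0F 2F = b
  tri s a b 1F 1F = 1#
  tri s a b 2F 2F = s
  tri s a b _  _  = 0#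

  unipotent : Carrier → Mat
  unipotent b = tri 1# 0# b

  reflection : Carrier → Carrier → Mat
  reflection a b = tri (- 1#) a b

  infix 4 _≋_
  _≋_ : Mat → Mat → Set
  A ≋ B = ∀ i j → A i j ≈ B i j

  ≋-setoid : Setoid 0ℓ 0ℓ
  ≋-setoid = record
    { Carrier       = Mat
    ; _≈_           = _≋_
    ; isEquivalence = record
      { refl  = λ i j → refl
      ; sym   = λ A≋B i j → sym (A≋B i j)
      ; trans = λ A≋B B≋C i j → trans (A≋B i j) (B≋C i j)
      }
    }

  open Setoid ≋-setoid using () renaming (sym to ≋-sym; trans to ≋-trans)
  module ≋-Reasoning = SetoidReasoning ≋-setoid

  ⊗-congˡ : ∀ A {B C} → B ≋ C → A ⊗ B ≋ A ⊗ C
  ⊗-congˡ A B≋C i j = +-cong (*-congˡ (B≋C 0F j)) (+-cong (*-congˡ (B≋C 1F j)) (*-congˡ (B≋C 2F j)))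

  tri-cong : ∀ {s s′ a a′ b b′} → s ≈ s′ → a ≈ a′ → b ≈ b′ → tri s a b ≋ tri s′ a′ b′
  tri-cong s≈s′ a≈a′ b≈b′ 0F 0F = s≈s′
  tri-cong s≈s′ a≈a′ b≈b′ 0F 1F = a≈a′
  tri-cong s≈s′ a≈a′ b≈b′ 0F 2F = b≈b′
  tri-cong s≈s′ a≈a′ b≈b′ 1F 0F = refl
  tri-cong s≈s′ a≈a′ b≈b′ 1F 1F = refl
  tri-cong s≈s′ a≈a′ b≈b′ 1F 2F = refl
  tri-cong s≈s′ a≈a′ b≈b′ 2F 0F = refl
  tri-cong s≈s′ a≈a′ b≈b′ 2F 1F = refl
  tri-cong s≈s′ a≈a′ b≈b′ 2F 2F = s≈s′

  I≋unipotent0 : I ≋ unipotent 0#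
  I≋unipotent0 0F 0F = refl
  I≋unipotent0 0F 1F = refl
  I≋unipotent0 0F 2F = refl
  I≋unipotent0 1F 0F = refl
  I≋unipotent0 1F 1F = refl
  I≋unipotent0 1F 2F = refl
  I≋unipotent0 2F 0F = refl
  I≋unipotent0 2F 1F = refl
  I≋unipotent0 2F 2F = refl

  tri-⊗ : ∀ s a b s′ a′ b′ → tri s a b ⊗ tri s′ a′ b′ ≋ tri (s * s′) (s * a′ + a) (s * b′ + b * s′)
  tri-⊗ s a b s′ a′ b′ 0F 0F =
    solve 4 (λ s a b s′ → s :* s′ :+ (a :* con 0 :+ b :* con 0) := s :* s′) refl s a b s′
  tri-⊗ s a b s′ a′ b′ 0F 1F =
    solve 4 (λ s a b a′ → s :* a′ :+ (a :* con 1 :+ b :* con 0) := s :* a′ :+ a) refl s a b a′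
  tri-⊗ s a b s′ a′ b′ 0F 2F =
    solve 5 (λ s a b s′ b′ → s :* b′ :+ (a :* con 0 :+ b :* s′) := s :* b′ :+ b :* s′) refl s a b s′ b′
  tri-⊗ s a b s′ a′ b′ 1F 0F =
    solve 1 (λ s′ → con 0 :* s′ :+ (con 1 :* con 0 :+ con 0 :* con 0) := con 0) refl s′
  tri-⊗ s a b s′ a′ b′ 1F 1F =
    solve 1 (λ a′ → con 0 :* a′ :+ (con 1 :* con 1 :+ con 0 :* con 0) := con 1) refl a′
  tri-⊗ s a b s′ a′ b′ 1F 2F =
    solve 2 (λ s′ b′ → con 0 :* b′ :+ (con 1 :* con 0 :+ con 0 :* s′) := con 0) refl s′ b′
  tri-⊗ s a b s′ a′ b′ 2F 0F =
    solve 2 (λ s s′ → con 0 :* s′ :+ (con 0 :* con 0 :+ s :* con 0) := con 0) refl s s′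
  tri-⊗ s a b s′ a′ b′ 2F 1F =
    solve 2 (λ s a′ → con 0 :* a′ :+ (con 0 :* con 1 :+ s :* con 0) := con 0) refl s a′
  tri-⊗ s a b s′ a′ b′ 2F 2F =
    solve 3 (λ s s′ b′ → con 0 :* b′ :+ (con 0 :* con 0 :+ s :* s′) := s :* s′) refl s s′ b′

  -1²≈1 : - 1# * - 1# ≈ 1#
  -1²≈1 = trans (-1*x≈-x (- 1#)) (-‿involutive 1#)

  b+x*b≈[1+x]*b : ∀ x b → b + x * b ≈ (1# + x) * b
  b+x*b≈[1+x]*b = solve 2 (λ x b → b :+ x :* b := (con 1 :+ x) :* b) refl

  unipotent-⊗-unipotent : ∀ b c → unipotent b ⊗ unipotent c ≋ unipotent (b + c)
  unipotent-⊗-unipotent b c = ≋-trans (tri-⊗ 1# 0# b 1# 0# c)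
    (tri-cong (*-identityˡ 1#) (trans (+-identityʳ _) (zeroʳ 1#))
      (solve 2 (λ b c → con 1 :* c :+ b :* con 1 := b :+ c) refl b c))

  reflection-⊗-unipotent : ∀ a b c → reflection a b ⊗ unipotent c ≋ reflection a (b - c)
  reflection-⊗-unipotent a b c = ≋-trans (tri-⊗ (- 1#) a b 1# 0# c)
    (tri-cong (*-identityʳ (- 1#)) (trans (+-congʳ (zeroʳ (- 1#))) (+-identityˡ a))
      (trans (+-cong (-1*x≈-x c) (*-identityʳ b)) (+-comm (- c) b)))

  reflection-⊗-reflection : ∀ a b c → reflection a b ⊗ reflection a c ≋ unipotent (- (b + c))
  reflection-⊗-reflection a b c = ≋-trans (tri-⊗ (- 1#) a b (- 1#) a c)
    (tri-cong -1²≈1 (trans (+-congʳ (-1*x≈-x a)) (-‿inverseˡ a)) (begin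
      - 1# * c + b * - 1#   ≈⟨ +-cong (-1*x≈-x c) (trans (*-comm b (- 1#)) (-1*x≈-x b)) ⟩
      - c + - b             ≈⟨ -‿+-comm c b ⟩
      - (c + b)             ≈⟨ -‿cong (+-comm c b) ⟩
      - (b + c)             ∎))
    where open ≈-Reasoning

  unipotent^ : ∀ b m → unipotent b ^^ m ≋ unipotent (m · 1# * b)
  unipotent^ b zero    = ≋-trans I≋unipotent0 (tri-cong refl refl (sym (zeroˡ b)))
  unipotent^ b (suc m) = begin
    unipotent b ⊗ (unipotent b ^^ m)       ≈⟨ ⊗-congˡ (unipotent b) (unipotent^ b m) ⟩
    unipotent b ⊗ unipotent (m · 1# * b)   ≈⟨ unipotent-⊗-unipotent b _ ⟩
    unipotent (b + m · 1# * b)             ≈⟨ tri-cong refl refl (b+x*b≈[1+x]*b _ b) ⟩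
    unipotent (suc m · 1# * b)             ∎
    where open ≋-Reasoning

  reflection^even : ∀ a b k → reflection a b ^^ (k ℕ.+ k) ≋ unipotent (- ((k ℕ.+ k) · 1# * b))
  reflection^odd  : ∀ a b k → reflection a b ^^ suc (k ℕ.+ k) ≋ reflection a (suc (k ℕ.+ k) · 1# * b)

  reflection^even a b zero = ≋-trans I≋unipotent0 (tri-cong refl refl (sym (trans (-‿cong (zeroˡ b)) -0#≈0#)))
  reflection^even a b (suc k) rewrite +-suc k k = begin
    reflection a b ⊗ (reflection a b ^^ suc (k ℕ.+ k))   ≈⟨ ⊗-congˡ (reflection a b) (reflection^odd a b k) ⟩
    reflection a b ⊗ reflection a (x * b)                ≈⟨ reflection-⊗-reflection a b _ ⟩
    unipotent (- (b + x * b))                            ≈⟨ tri-cong refl refl (-‿cong (b+x*b≈[1+x]*b x b)) ⟩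
    unipotent (- ((1# + x) * b))                         ∎
    where
    open ≋-Reasoning
    x = suc (k ℕ.+ k) · 1#

  reflection^odd a b k = begin
    reflection a b ⊗ (reflection a b ^^ (k ℕ.+ k))   ≈⟨ ⊗-congˡ (reflection a b) (reflection^even a b k) ⟩
    reflection a b ⊗ unipotent (- (x * b))           ≈⟨ reflection-⊗-unipotent a b _ ⟩
    reflection a (b - - (x * b))                     ≈⟨ tri-cong refl refl (+-congˡ (-‿involutive _)) ⟩
    reflection a (b + x * b)                         ≈⟨ tri-cong refl refl (b+x*b≈[1+x]*b x b) ⟩
    reflection a ((1# + x) * b)                      ∎
    where
    open ≋-Reasoning
    x = (k ℕ.+ k) · 1#

  reflection^-shape : ∀ a b m →
    (∃ λ t → reflection a b ^^ m ≋ unipotent (t * b)) ⊎ (∃ λ t → reflection a b ^^ m ≋ reflection a (t * b))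
  reflection^-shape a b m with parity m
  ... | even k = inj₁ (_ , ≋-trans (reflection^even a b k) (tri-cong refl refl (-‿distribˡ-* _ b)))
  ... | odd k  = inj₂ (_ , reflection^odd a b k)

  x-y≈x : ∀ {x y} → y ≈ 0# → x - y ≈ x
  x-y≈x y≈0 = trans (+-congˡ (trans (-‿cong y≈0) -0#≈0#)) (+-identityʳ _)

  det-tri : ∀ s a b → det (tri s a b) ≈ s * s
  det-tri s a b = begin
    s * (1# * s - 0# * 0#) - a * (0# * s - 0# * 0#) + b * (0# * 0# - 1# * 0#)
      ≈⟨ +-cong (+-cong (*-congˡ D₁) (-‿cong (*-congˡ D₂))) (*-congˡ D₃) ⟩
    s * s - a * 0# + b * 0#
      ≈⟨ +-cong (x-y≈x (zeroʳ a)) (zeroʳ b) ⟩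
    s * s + 0#
      ≈⟨ +-identityʳ _ ⟩
    s * s ∎
    where
    open ≈-Reasoning

    D₁ : 1# * s - 0# * 0# ≈ s
    D₁ = trans (x-y≈x (zeroˡ 0#)) (*-identityˡ s)
    D₂ : 0# * s - 0# * 0# ≈ 0#
    D₂ = trans (x-y≈x (zeroˡ 0#)) (zeroˡ s)
    D₃ : 0# * 0# - 1# * 0# ≈ 0#
    D₃ = trans (x-y≈x (zeroʳ 1#)) (zeroˡ 0#)

  unipotentSL : Carrier → SL3
  unipotentSL b = unipotent b , trans (det-tri 1# 0# b) (*-identityˡ 1#)

  reflectionSL : Carrier → Carrier → SL3
  reflectionSL a b = reflection a b , trans (det-tri (- 1#) a b) -1²≈1

  ≋⇒∼ : ∀ {A B} → A ≋ B → A ∼ B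
  ≋⇒∼ A≋B = 1# , trans (*-identityˡ _) (*-identityˡ 1#) , λ i j → trans (A≋B i j) (sym (*-identityˡ _))

  ∼-respʳ-≋ : ∀ {A B C} → B ≋ C → A ∼ B → A ∼ C
  ∼-respʳ-≋ B≋C (c , c³≈1 , A≈cB) = c , c³≈1 , λ i j → trans (A≈cB i j) (*-congˡ (B≋C i j))

  ∼⇒≋ : ∀ {A B} → A 1F 1F ≈ 1# → B 1F 1F ≈ 1# → A ∼ B → A ≋ B
  ∼⇒≋ {A} {B} A₁₁≈1 B₁₁≈1 (c , _ , A≈cB) i j = trans (A≈cB i j) (trans (*-congʳ c≈1) (*-identityˡ _))
    where
    open ≈-Reasoning

    c≈1 : c ≈ 1#
    c≈1 = begin
      c            ≈⟨ *-identityʳ c ⟨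
      c * 1#       ≈⟨ *-congˡ B₁₁≈1 ⟨
      c * B 1F 1F  ≈⟨ A≈cB 1F 1F ⟨
      A 1F 1F      ≈⟨ A₁₁≈1 ⟩
      1#           ∎

  tri-∼⇒≈ : ∀ {s a b s′ a′ b′} → tri s a b ∼ tri s′ a′ b′ → s ≈ s′ × a ≈ a′ × b ≈ b′
  tri-∼⇒≈ T∼T′ = let T≋T′ = ∼⇒≋ refl refl T∼T′ in T≋T′ 0F 0F , T≋T′ 0F 1F , T≋T′ 0F 2F

  unipotent≁unipotent : ∀ {b c} → ¬ b ≈ c → ¬ unipotent b ∼ unipotent c
  unipotent≁unipotent b≉c = b≉c ∘′ proj₂ ∘′ proj₂ ∘′ tri-∼⇒≈

  reflection≁reflectionᵃ : ∀ {a b a′ b′} → ¬ a ≈ a′ → ¬ reflection a b ∼ reflection a′ b′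
  reflection≁reflectionᵃ a≉a′ = a≉a′ ∘′ proj₁ ∘′ proj₂ ∘′ tri-∼⇒≈

  reflection≁reflectionᵇ : ∀ {a b a′ b′} → ¬ b ≈ b′ → ¬ reflection a b ∼ reflection a′ b′
  reflection≁reflectionᵇ b≉b′ = b≉b′ ∘′ proj₂ ∘′ proj₂ ∘′ tri-∼⇒≈

  Adjacent : SL3 → SL3 → Set
  Adjacent A B = PowAdj A B × PowAdj B A

  NonAdjacent : SL3 → SL3 → Set
  NonAdjacent A B = (¬ proj₁ A ∼ proj₁ B × ¬ PowAdj A B) × (¬ proj₁ B ∼ proj₁ A × ¬ PowAdj B A)

  power⇒Adjacent : ∀ {A B : SL3} m → ¬ proj₁ A ∼ proj₁ B → ¬ proj₁ B ∼ proj₁ A →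
    1 ℕ.≤ m → proj₁ A ∼ (proj₁ B ^^ m) → Adjacent A B
  power⇒Adjacent m A≁B B≁A 1≤m A∼Bᵐ = (A≁B , inj₁ (m , 1≤m , A∼Bᵐ)) , (B≁A , inj₂ (m , 1≤m , A∼Bᵐ))

  powerFree⇒¬PowAdj : ∀ {A B : SL3} →
    (∀ m → ¬ proj₁ A ∼ (proj₁ B ^^ m)) → (∀ m → ¬ proj₁ B ∼ (proj₁ A ^^ m)) → ¬ PowAdj A B
  powerFree⇒¬PowAdj A∉⟨B⟩ B∉⟨A⟩ (_ , inj₁ (m , _ , A∼Bᵐ)) = A∉⟨B⟩ m A∼Bᵐ
  powerFree⇒¬PowAdj A∉⟨B⟩ B∉⟨A⟩ (_ , inj₂ (m , _ , B∼Aᵐ)) = B∉⟨A⟩ m B∼Aᵐ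

  powerFree⇒NonAdjacent : ∀ {A B : SL3} → ¬ proj₁ A ∼ proj₁ B → ¬ proj₁ B ∼ proj₁ A →
    (∀ m → ¬ proj₁ A ∼ (proj₁ B ^^ m)) → (∀ m → ¬ proj₁ B ∼ (proj₁ A ^^ m)) → NonAdjacent A B
  powerFree⇒NonAdjacent {A} {B} A≁B B≁A A∉⟨B⟩ B∉⟨A⟩ =
    (A≁B , powerFree⇒¬PowAdj {A} {B} A∉⟨B⟩ B∉⟨A⟩) , (B≁A , powerFree⇒¬PowAdj {B} {A} B∉⟨A⟩ A∉⟨B⟩)

  0≉1 : ¬ 0# ≈ 1#
  0≉1 = 1≉0 ∘′ sym

  -1≉0 : ¬ - 1# ≈ 0#
  -1≉0 -1≈0 = 1≉0 (trans (sym (-‿involutive 1#)) (trans (-‿cong -1≈0) -0#≈0#))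

  module _ (1+1≉0 : ¬ (1# + 1# ≈ 0#)) where

    1≉-1 : ¬ 1# ≈ - 1#
    1≉-1 1≈-1 = 1+1≉0 (trans (+-congʳ 1≈-1) (-‿inverseˡ 1#))

    unipotent≁reflection : ∀ {b a c} → ¬ unipotent b ∼ reflection a c
    unipotent≁reflection = 1≉-1 ∘′ proj₁ ∘′ tri-∼⇒≈

    reflection≁unipotent : ∀ {a b c} → ¬ reflection a b ∼ unipotent c
    reflection≁unipotent = 1≉-1 ∘′ sym ∘′ proj₁ ∘′ tri-∼⇒≈

    reflection≁unipotent^ : ∀ {a b c} m → ¬ reflection a b ∼ (unipotent c ^^ m)
    reflection≁unipotent^ {c = c} m = reflection≁unipotent ∘′ ∼-respʳ-≋ (unipotent^ c m)

    reflection≁reflection^ : ∀ {a b a′ b′} → ¬ a ≈ a′ → ∀ m → ¬ reflection a b ∼ (reflection a′ b′ ^^ m)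
    reflection≁reflection^ {a′ = a′} {b′} a≉a′ m R∼R′ᵐ with reflection^-shape a′ b′ m
    ... | inj₁ (_ , R′ᵐ≋U) = reflection≁unipotent (∼-respʳ-≋ R′ᵐ≋U R∼R′ᵐ)
    ... | inj₂ (_ , R′ᵐ≋R) = reflection≁reflectionᵃ a≉a′ (∼-respʳ-≋ R′ᵐ≋R R∼R′ᵐ)

    unipotent≁involution^ : ∀ {c a} → ¬ c ≈ 0# → ∀ m → ¬ unipotent c ∼ (reflection a 0# ^^ m)
    unipotent≁involution^ {c} {a} c≉0 m U∼Rᵐ with reflection^-shape a 0# m
    ... | inj₁ (t , Rᵐ≋U) = unipotent≁unipotent (λ c≈t0 → c≉0 (trans c≈t0 (zeroʳ t))) (∼-respʳ-≋ Rᵐ≋U U∼Rᵐ)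
    ... | inj₂ (_ , Rᵐ≋R) = unipotent≁reflection (∼-respʳ-≋ Rᵐ≋R U∼Rᵐ)

    unipotent⋯involution : ∀ {c a} → ¬ c ≈ 0# → NonAdjacent (unipotentSL c) (reflectionSL a 0#)
    unipotent⋯involution {c} {a} c≉0 = powerFree⇒NonAdjacent {unipotentSL c} {reflectionSL a 0#}
      unipotent≁reflection reflection≁unipotent (unipotent≁involution^ c≉0) reflection≁unipotent^

    reflection⋯reflection : ∀ {a b a′ b′} → ¬ a ≈ a′ → ¬ a′ ≈ a →
      NonAdjacent (reflectionSL a b) (reflectionSL a′ b′)
    reflection⋯reflection {a} {b} {a′} {b′} a≉a′ a′≉a =
      powerFree⇒NonAdjacent {reflectionSL a b} {reflectionSL a′ b′}
        (reflection≁reflectionᵃ a≉a′) (reflection≁reflectionᵃ a′≉a)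
        (reflection≁reflection^ a≉a′) (reflection≁reflection^ a′≉a)

    module _ (k : ℕ) (N·1≈0 : suc (k ℕ.+ k) · 1# ≈ 0#) where

      N : ℕ
      N = suc (k ℕ.+ k)

      reflection^N : ∀ a b → reflection a b ^^ N ≋ reflection a 0#
      reflection^N a b = ≋-trans (reflection^odd a b k) (tri-cong refl refl (trans (*-congʳ N·1≈0) (zeroˡ b)))

      reflection^[N+1] : ∀ a b → reflection a b ^^ (suc k ℕ.+ suc k) ≋ unipotent (- b)
      reflection^[N+1] a b = ≋-trans (reflection^even a b (suc k))
        (tri-cong refl refl (-‿cong (trans (*-congʳ [N+1]·1≈1) (*-identityˡ b))))
        where
        [N+1]·1≈1 : (suc k ℕ.+ suc k) · 1# ≈ 1#
        [N+1]·1≈1 = trans (+-congˡ (trans (reflexive (≡.cong (_· 1#) (+-suc k k))) N·1≈0)) (+-identityʳ 1#)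

      g₁ y₁ u y₂ g₂ : SL3
      g₁ = reflectionSL 0# 0#
      y₁ = reflectionSL 0# 1#
      u  = unipotentSL (- 1#)
      y₂ = reflectionSL 1# 1#
      g₂ = reflectionSL 1# 0#

      g₁—y₁ : Adjacent g₁ y₁
      g₁—y₁ = power⇒Adjacent {g₁} {y₁} N
        (reflection≁reflectionᵇ 0≉1) (reflection≁reflectionᵇ 1≉0) (ℕ.s≤s ℕ.z≤n)
        (≋⇒∼ (≋-sym (reflection^N 0# 1#)))

      u—y₁ : Adjacent u y₁
      u—y₁ = power⇒Adjacent {u} {y₁} (suc k ℕ.+ suc k)
        unipotent≁reflection reflection≁unipotent (ℕ.s≤s ℕ.z≤n)
        (≋⇒∼ (≋-sym (reflection^[N+1] 0# 1#)))

      u—y₂ : Adjacent u y₂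
      u—y₂ = power⇒Adjacent {u} {y₂} (suc k ℕ.+ suc k)
        unipotent≁reflection reflection≁unipotent (ℕ.s≤s ℕ.z≤n)
        (≋⇒∼ (≋-sym (reflection^[N+1] 1# 1#)))

      g₂—y₂ : Adjacent g₂ y₂
      g₂—y₂ = power⇒Adjacent {g₂} {y₂} N
        (reflection≁reflectionᵇ 0≉1) (reflection≁reflectionᵇ 1≉0) (ℕ.s≤s ℕ.z≤n)
        (≋⇒∼ (≋-sym (reflection^N 1# 1#)))

      vertex : Fin 5 → SL3
      vertex 0F = g₁
      vertex 1F = y₁
      vertex 2F = u
      vertex 3F = y₂
      vertex 4F = g₂

      Faithful : Fin 5 → Fin 5 → Set
      Faithful i j = ¬ proj₁ (vertex i) ∼ proj₁ (vertex j)
                   × (P5 i j → PowAdj (vertex i) (vertex j)) × (PowAdj (vertex i) (vertex j) → P5 i j)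

      edge : ∀ {i j} {_ : True (P5? i j)} → PowAdj (vertex i) (vertex j) → Faithful i j
      edge {_} {_} {i—j} adj = proj₁ adj , const adj , const (toWitness i—j)

      nonEdge : ∀ {i j} {_ : False (P5? i j)} →
        ¬ proj₁ (vertex i) ∼ proj₁ (vertex j) × ¬ PowAdj (vertex i) (vertex j) → Faithful i j
      nonEdge {_} {_} {i⋯j} (i≁j , ¬adj) =
        i≁j , (λ i—j → contradiction i—j (toWitnessFalse i⋯j)) , (λ adj → contradiction adj ¬adj)

      faithful : ∀ i j → i ≢ j → Faithful i j
      faithful 0F 0F i≢i = contradiction ≡.refl i≢i
      faithful 0F 1F _   = edge (proj₁ g₁—y₁)
      faithful 0F 2F _   = nonEdge (proj₂ (unipotent⋯involution -1≉0))
      faithful 0F 3F _   = nonEdge (proj₁ (reflection⋯reflection 0≉1 1≉0))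
      faithful 0F 4F _   = nonEdge (proj₁ (reflection⋯reflection 0≉1 1≉0))
      faithful 1F 0F _   = edge (proj₂ g₁—y₁)
      faithful 1F 1F i≢i = contradiction ≡.refl i≢i
      faithful 1F 2F _   = edge (proj₂ u—y₁)
      faithful 1F 3F _   = nonEdge (proj₁ (reflection⋯reflection 0≉1 1≉0))
      faithful 1F 4F _   = nonEdge (proj₁ (reflection⋯reflection 0≉1 1≉0))
      faithful 2F 0F _   = nonEdge (proj₁ (unipotent⋯involution -1≉0))
      faithful 2F 1F _   = edge (proj₁ u—y₁)
      faithful 2F 2F i≢i = contradiction ≡.refl i≢i
      faithful 2F 3F _   = edge (proj₁ u—y₂)
      faithful 2F 4F _   = nonEdge (proj₁ (unipotent⋯involution -1≉0))
      faithful 3F 0F _   = nonEdge (proj₂ (reflection⋯reflection 0≉1 1≉0))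
      faithful 3F 1F _   = nonEdge (proj₂ (reflection⋯reflection 0≉1 1≉0))
      faithful 3F 2F _   = edge (proj₂ u—y₂)
      faithful 3F 3F i≢i = contradiction ≡.refl i≢i
      faithful 3F 4F _   = edge (proj₂ g₂—y₂)
      faithful 4F 0F _   = nonEdge (proj₂ (reflection⋯reflection 0≉1 1≉0))
      faithful 4F 1F _   = nonEdge (proj₂ (reflection⋯reflection 0≉1 1≉0))
      faithful 4F 2F _   = nonEdge (proj₂ (unipotent⋯involution -1≉0))
      faithful 4F 3F _   = edge (proj₁ g₂—y₂)
      faithful 4F 4F i≢i = contradiction ≡.refl i≢i

      P5-induced : HasInduced 5 P5
      P5-induced = vertex , (λ i j i≢j → proj₁ (faithful i j i≢j)) , (λ i j i≢j → proj₂ (faithful i j i≢j))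

mainTheorem18 : (q : ℕ) → OddPrimePower q → (F : FiniteField q) → NotP5coP5Free F
mainTheorem18 q q-oddPrimePower F =
  let 1+1≉0     = odd⇒1+1≉0 F (oddPrimePower⇒odd q-oddPrimePower)
      k , N·1≈0 = oddCharacteristic F 1+1≉0
  in inj₁ (P5-induced F 1+1≉0 k N·1≈0)
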